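{- Let $f$ be a manageable width function. There is a function $h$ such that for every hypergraph $H$, every rooted tree decomposition $\mathbf{t}=(T,\mathrm{bag})$ of $H$ and every elimination forest $F$ of $H$, every node $x\in V(T)$ has degree at most $h(\mathrm{split}(\mathbf{t},F),\mathrm{mir}(\mathbf{t},F),f\text{ -width}(\mathbf{t}),\mathrm{rank}(H))$ in the stain intersection graph $\mathrm{SG}(\mathbf{t},F)$.
   Context: Hypergraph $H$: finite $V(H)$, edges non-empty subsets, each vertex in an edge; $\mathrm{rank}(H)$ = max edge size; $H[U]$ has edges $\{e\cap U\ne\emptyset\}$; disjoint sets are non-adjacent if no edge meets both. Manageable width function $f$ (values $f_H(U)\ge0$): weakly additive on disjoint non-adjacent sets; there is computable $\beta$ with $f_H(U)\le k\Rightarrow|U|\le\beta(k,\mathrm{rank}(H))$; $H_1[U_1]\cong H_2[U_2]\Rightarrow f_{H_1}(U_1)=f_{H_2}(U_2)$; $f_H(V(H))$ computable in time bounded by a function of $|V(H)|$. A rooted tree decomposition $\mathbf{t}=(T,\mathrm{bag})$: rooted tree, bags covering every edge, each vertex's bags forming a connected subtree; $f\text{ -width}(\mathbf{t})=\max_x f_H(\mathrm{bag}(x))$. $\mathrm{adh}(x)=\mathrm{bag}(x)\cap\mathrm{bag}(\text{parent})$ ($\emptyset$ at root), $\mathrm{mrg}(x)=\mathrm{bag}(x)\setminus\mathrm{adh}(x)$, $\mathrm{cmp}(x)=\bigcup_{y\text{ descendant of }x}\mathrm{mrg}(y)$; $\mathrm{mn}(u)$ is the unique node with $u\in\mathrm{mrg}(\mathrm{mn}(u))$.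 Elimination forest $F$: rooted forest on $V(H)$ where vertices of a common edge are in ancestor–descendant relation. Factors ($F_x$ = descendants of $x$ incl. $x$): tree factor $F_x$; forest factor = non-empty union of tree factors with sibling roots; context factor = $F_x\setminus B$, $B$ a forest factor with roots strict descendants of $x$. $\mathrm{MF}(U)$ = inclusion-maximal factors inside $U$; $U$ well-formed if $\mathrm{MF}(U)$ has no context factor. $\mathrm{split}(\mathbf{t},F)=\max_x|\mathrm{MF}(\mathrm{cmp}(x))|$; $\mathrm{mir}(\mathbf{t},F)$ = max over $x$ of the number of children $y$ of $x$ with $\mathrm{cmp}(y)$ not well-formed. $\mathrm{Stain}(u)=\{\mathrm{mn}(u)\}\cup\bigcup_{v\text{ child of }u\text{ in }F}$ (vertices of the $T$-path from $\mathrm{mn}(u)$ to $\mathrm{mn}(v)$). $\mathrm{SG}(\mathbf{t},F)$ is the bipartite graph with parts $V(T)$ and $V(H)$, where $x\in V(T)$ is adjacent to $u\in V(H)$ iff $x\in\mathrm{Stain}(u)$.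
   Formalization: The manageable width function f takes non-negative rational values rather than non-negative reals, so β and the width argument of h are taken over the rationals as well. -}

module Defs where

open import Data.Nat using (ℕ; zero; suc; _<_; _≤_; _⊔_)
open import Data.Fin using (Fin)
open import Data.Fin.Subset using (Subset; _∈_; _∉_; _⊆_; _∩_; _∪_; Nonempty)
open import Data.List using (List; []; _∷_; length; foldr; map; allFin)
import Data.List.Membership.Propositional as LM
open import Data.List.Relation.Unary.All using (All)
open import Data.List.Relation.Unary.Any using (Any)
open import Data.List.Relation.Unary.Unique.Propositional using (Unique)
open import Data.Maybe using (Maybe; just; nothing)
open import Data.Product using (Σ; ∃; _×_; _,_)
open import Data.Sum using (_⊎_)
open import Relation.Nullary using (¬_)
open import Relation.Binary.PropositionalEquality using (_≡_; _≢_)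
open import Data.Rational as ℚ using (ℚ; 0ℚ)

record Hypergraph : Set where
  field
    n        : ℕ
    edges    : List (Subset n)
    nonempty : All Nonempty edges
    covered  : ∀ (v : Fin n) → Any (v ∈_) edges

open Hypergraph public

rank : Hypergraph → ℕ
rank H = foldr (λ e m → Data.Fin.Subset.∣ e ∣ ⊔ m) 0 (edges H)

NonAdjacent : (H : Hypergraph) → Subset (n H) → Subset (n H) → Set
NonAdjacent H U₁ U₂ =
  ∀ e → e LM.∈ edges H → ¬ (Nonempty (e ∩ U₁) × Nonempty (e ∩ U₂))

Disjoint : {k : ℕ} → Subset k → Subset k → Set
Disjoint U₁ U₂ = ∀ v → v ∈ U₁ → v ∉ U₂

EdgesMapped : (H₁ H₂ : Hypergraph) (U₁ : Subset (n H₁)) (U₂ : Subset (n H₂))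
              (φ : Fin (n H₁) → Fin (n H₂)) → Set
EdgesMapped H₁ H₂ U₁ U₂ φ =
  ∀ e₁ → e₁ LM.∈ edges H₁ → Nonempty (e₁ ∩ U₁) →
    Σ (Subset (n H₂)) λ e₂ → e₂ LM.∈ edges H₂ × Nonempty (e₂ ∩ U₂) ×
      (∀ v → v ∈ U₁ → (v ∈ e₁ → φ v ∈ e₂) × (φ v ∈ e₂ → v ∈ e₁))

-- H₁[U₁] ≅ H₂[U₂]: a bijection U₁ → U₂ mapping the edge set of H₁[U₁]
-- (= {e ∩ U₁ ≠ ∅}) exactly onto the edge set of H₂[U₂].
InducedIso : (H₁ : Hypergraph) → Subset (n H₁) → (H₂ : Hypergraph) → Subset (n H₂) → Set
InducedIso H₁ U₁ H₂ U₂ =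
  Σ (Fin (n H₁) → Fin (n H₂)) λ φ → Σ (Fin (n H₂) → Fin (n H₁)) λ ψ →
    (∀ v → v ∈ U₁ → φ v ∈ U₂) × (∀ w → w ∈ U₂ → ψ w ∈ U₁) ×
    (∀ v → v ∈ U₁ → ψ (φ v) ≡ v) × (∀ w → w ∈ U₂ → φ (ψ w) ≡ w) ×
    EdgesMapped H₁ H₂ U₁ U₂ φ × EdgesMapped H₂ H₁ U₂ U₁ ψ

WidthFunction : Set
WidthFunction = (H : Hypergraph) → Subset (n H) → ℚ

record Manageable (f : WidthFunction) : Set where
  field
    nonneg   : ∀ H U → 0ℚ ℚ.≤ f H U
    weaklyAdditive : ∀ H U₁ U₂ → Disjoint U₁ U₂ → NonAdjacent H U₁ U₂ →
                     f H U₁ ℚ.+ f H U₂ ℚ.≤ f H (U₁ ∪ U₂)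
    β        : ℚ → ℕ → ℕ
    β-bound  : ∀ H U (k : ℚ) → f H U ℚ.≤ k → Data.Fin.Subset.∣ U ∣ ≤ β k (rank H)
    isoInv   : ∀ H₁ U₁ H₂ U₂ → InducedIso H₁ U₁ H₂ U₂ → f H₁ U₁ ≡ f H₂ U₂

-- Rooted forests on Fin k, given by a parent map (nothing = root),
-- well-founded via a strictly decreasing depth.

record RootedForest (k : ℕ) : Set where
  field
    parent    : Fin k → Maybe (Fin k)
    depth     : Fin k → ℕ
    depth-dec : ∀ x y → parent x ≡ just y → depth y < depth x

-- Anc P a b : a is an ancestor of b or a = b (b is a descendant of a)
data Anc {k : ℕ} (P : RootedForest k) : Fin k → Fin k → Set where
  here : ∀ {a} → Anc P a a
  up   : ∀ {a b c} → RootedForest.parent P c ≡ just b → Anc P a b → Anc P a c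

record RootedTree (k : ℕ) : Set where
  field
    forest     : RootedForest k
    root       : Fin k
    root-root  : RootedForest.parent forest root ≡ nothing
    root-uniq  : ∀ x → RootedForest.parent forest x ≡ nothing → x ≡ root

OnPath : {k : ℕ} → RootedForest k → Fin k → Fin k → Fin k → Set
OnPath P a b z = (Anc P z a ⊎ Anc P z b) × (∀ w → Anc P w a → Anc P w b → Anc P w z)

record TreeDec (H : Hypergraph) : Set where
  field
    m      : ℕ
    T      : RootedTree m
    bag    : Fin m → Subset (n H)
    covers : ∀ e → e LM.∈ edges H → ∃ λ x → e ⊆ bag x
    connected : ∀ v x y z → v ∈ bag x → v ∈ bag y →
                OnPath (RootedTree.forest T) x y z → v ∈ bag z

module _ {H : Hypergraph} (t : TreeDec H) where
  open TreeDec t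
  private P = RootedTree.forest T

  -- v ∈ adh(x) = bag(x) ∩ bag(parent x), empty at the root
  InAdh : Fin m → Fin (n H) → Set
  InAdh x v = v ∈ bag x × Σ (Fin m) λ p → RootedForest.parent P x ≡ just p × v ∈ bag p

  InMrg : Fin m → Fin (n H) → Set
  InMrg x v = v ∈ bag x × ¬ InAdh x v

  InCmp : Fin m → Fin (n H) → Set
  InCmp x v = Σ (Fin m) λ y → Anc P x y × InMrg y v

  ChildT : Fin m → Fin m → Set
  ChildT y x = RootedForest.parent P y ≡ just x

fwidth : (f : WidthFunction) {H : Hypergraph} → TreeDec H → ℚ
fwidth f {H} t = foldr ℚ._⊔_ 0ℚ (map (λ x → f H (TreeDec.bag t x)) (allFin (TreeDec.m t)))

record ElimForest (H : Hypergraph) : Set where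
  field
    forest : RootedForest (n H)
    edgeChain : ∀ e → e LM.∈ edges H → ∀ u v → u ∈ e → v ∈ e →
                Anc forest u v ⊎ Anc forest v u

module _ {H : Hypergraph} (F : ElimForest H) where
  private P = ElimForest.forest F

  IsTreeFactor : Subset (n H) → Set
  IsTreeFactor S = Σ (Fin (n H)) λ x → ∀ v → (v ∈ S → Anc P x v) × (Anc P x v → v ∈ S)

  SiblingRoots : Subset (n H) → Set
  SiblingRoots R = Nonempty R ×
    (∀ r r' → r ∈ R → r' ∈ R → RootedForest.parent P r ≡ RootedForest.parent P r')

  InUnion : Subset (n H) → Fin (n H) → Set
  InUnion R v = Σ (Fin (n H)) λ r → r ∈ R × Anc P r v

  IsForestFactor : Subset (n H) → Set
  IsForestFactor S = Σ (Subset (n H)) λ R → SiblingRoots R ×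
    (∀ v → (v ∈ S → InUnion R v) × (InUnion R v → v ∈ S))

  -- S = F_x \ B, B a forest factor whose roots are strict descendants of x
  IsContextFactor : Subset (n H) → Set
  IsContextFactor S = Σ (Fin (n H)) λ x → Σ (Subset (n H)) λ R → SiblingRoots R ×
    (∀ r → r ∈ R → Anc P x r × r ≢ x) ×
    (∀ v → (v ∈ S → Anc P x v × ¬ InUnion R v) × (Anc P x v × ¬ InUnion R v → v ∈ S))

  IsFactor : Subset (n H) → Set
  IsFactor S = IsTreeFactor S ⊎ IsForestFactor S ⊎ IsContextFactor S

  InMF : (Fin (n H) → Set) → Subset (n H) → Set
  InMF U S = IsFactor S × (∀ v → v ∈ S → U v) ×
    (∀ S' → IsFactor S' → S ⊆ S' → (∀ v → v ∈ S' → U v) → S' ≡ S)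

  WellFormed : (Fin (n H) → Set) → Set
  WellFormed U = ∀ S → InMF U S → ¬ IsContextFactor S

CountIs : {A : Set} → (A → Set) → ℕ → Set
CountIs {A} P k = Σ (List A) λ xs → Unique xs × length xs ≡ k ×
  (∀ a → (P a → a LM.∈ xs) × (a LM.∈ xs → P a))

IsMaxOver : {m : ℕ} → (Fin m → ℕ → Set) → ℕ → Set
IsMaxOver {m} R s = (∀ x k → R x k → k ≤ s) × Σ (Fin m) λ x → R x s

module _ {H : Hypergraph} (t : TreeDec H) (F : ElimForest H) where
  open TreeDec t

  IsSplit : ℕ → Set
  IsSplit = IsMaxOver (λ x k → CountIs (InMF F (InCmp t x)) k)

  IsMir : ℕ → Set
  IsMir = IsMaxOver (λ x k → CountIs (λ y → ChildT t y x × ¬ WellFormed F (InCmp t y)) k)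

  -- x ∈ Stain(u); mn(u) = a is characterised by u ∈ mrg(a)
  InStain : Fin m → Fin (n H) → Set
  InStain x u = Σ (Fin m) λ a → InMrg t a u ×
    (x ≡ a ⊎ Σ (Fin (n H)) λ v → RootedForest.parent (ElimForest.forest F) v ≡ just u ×
                 Σ (Fin m) λ b → InMrg t b v × OnPath (RootedTree.forest T) a b x)

-- A vertex u is stained at the node x either because x = mn(u), or because x lies on the
-- tree path from mn(u) to mn(v) for a child v of u in F.  If x is an end of that path, u or
-- its child v lies in bag(x), which has at most β(f-width, rank) elements.  Otherwise x is
-- strictly above mn(u) or mn(v).  Above mn(u) only: u ∈ cmp(x) but v ∉ cmp(x), so the
-- maximal factor of cmp(x) containing u has a hole at u.  Above mn(v) only: the maximal
-- factor of cmp(x) containing v hangs from u.  Above both: for the child y of x toward mn(u),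
-- u ∈ cmp(y) but v ∉ cmp(y), so the maximal factor of cmp(y) containing u has a hole; a
-- factor with a hole is a context factor, so cmp(y) is not well-formed, and there are at most
-- mir such children y.  A factor has at most one hole and hangs from at most one vertex, so
-- u is determined by its factor, and x has degree at most 2β + (2 + mir)·split.

module Submission where

open import Defs
open import Data.Bool using (Bool; if_then_else_)
open import Data.Fin using (Fin; zero; suc) renaming (_≟_ to _≟ᶠ_)
open import Data.Fin.Properties using (any?; all?)
open import Data.Fin.Subset using (Subset; _∈_; _∉_; _⊆_; _⊂_; _⊃_; ⁅_⁆; inside; outside; ∣_∣)
open import Data.Fin.Subset.Induction using (⊃-wellFounded)
open import Data.Fin.Subset.Properties
  using (_∈?_; _⊂?_; nonempty?; anySubset?; ⊆-refl; ⊆-trans; ⊆-antisym; x∈⁅x⁆; x∈⁅y⁆⇒x≡y)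
open import Data.List using (List; []; _∷_; length; map; _++_; filter; concatMap; foldr; allFin)
open import Data.List.Properties using (length-++; length-map; length-removeAt′)
open import Data.List.Membership.Propositional using () renaming (_∈_ to _∈ˡ_)
open import Data.List.Membership.Propositional.Properties
  using (∈-map⁺; ∈-map⁻; ∈-++⁺ˡ; ∈-++⁺ʳ; ∈-filter⁺; ∈-filter⁻; ∈-allFin; ∈-concatMap⁺)
open import Data.List.Relation.Unary.All using (All; []; _∷_)
import Data.List.Relation.Unary.All as All
import Data.List.Relation.Unary.Any as Any
open import Data.List.Relation.Unary.Any using (Any; here; there; _─_)
open import Data.List.Relation.Unary.AllPairs using ([]; _∷_)
open import Data.List.Relation.Unary.Unique.Propositional using (Unique)
import Data.List.Relation.Unary.Unique.Propositional.Properties as Unique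
open import Data.Maybe using (just; nothing)
open import Data.Maybe.Properties using (just-injective)
import Data.Maybe.Properties as Maybe
open import Data.Nat using (ℕ; zero; suc; _+_; _*_; _≤_; _<_; z≤n; s≤s)
open import Data.Nat.Induction using (<-wellFounded)
open import Data.Nat.Properties
  using (≤-refl; ≤-trans; <⇒≤; ≤-<-trans; ≤⇒≯; <-irrefl; +-mono-≤; +-monoˡ-≤; +-monoʳ-≤; *-monoˡ-≤; *-monoʳ-≤;
         module ≤-Reasoning)
open import Data.Nat.Tactic.RingSolver using (solve-∀)
open import Data.Product using (Σ; ∃; _×_; _,_; proj₁; proj₂)
open import Data.Rational as ℚ using (ℚ; 0ℚ)
import Data.Rational.Properties as ℚ
open import Data.Sum using (_⊎_; inj₁; inj₂; [_,_]′; map₂)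
open import Data.Vec using ([]; _∷_; here; there; tabulate)
open import Data.Vec.Properties using (lookup⇒[]=; []=⇒lookup; lookup∘tabulate)
open import Function using (_∘_; _on_; id)
open import Level using (Level)
open import Induction.WellFounded using (Acc; acc)
open import Relation.Binary.Construct.On as On using ()
open import Relation.Binary.PropositionalEquality using (_≡_; _≢_; refl; sym; trans; cong; subst)
open import Relation.Nullary using (¬_; Dec; yes; no; does; contradiction)
open import Relation.Nullary.Decidable using (_×-dec_; _⊎-dec_; _→-dec_; ¬?; decidable-stable)
import Relation.Nullary.Decidable as Dec
open import Relation.Unary using (Pred; Decidable)

∈-─⁺ : {A : Set} {x y : A} {xs : List A} (p : x ∈ˡ xs) → y ∈ˡ xs → x ≡ y ⊎ y ∈ˡ (xs ─ p)
∈-─⁺ (here refl) (here refl) = inj₁ refl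
∈-─⁺ (here refl) (there q)   = inj₂ q
∈-─⁺ (there p)   (here refl) = inj₂ (here refl)
∈-─⁺ (there p)   (there q)   = map₂ there (∈-─⁺ p q)

injective-coding⇒length≤ : {A C : Set} (Code : A → C → Set) →
  (∀ {a a' c} → Code a c → Code a' c → a ≡ a') →
  ∀ {as} → Unique as → (cs : List C) →
  All (λ a → ∃ λ c → c ∈ˡ cs × Code a c) as → length as ≤ length cs
injective-coding⇒length≤ Code inj [] cs [] = z≤n
injective-coding⇒length≤ Code inj {a ∷ as} (a∉as ∷ as!) cs ((c , c∈cs , a↦c) ∷ coded) =
  subst (suc (length as) ≤_) (sym (length-removeAt′ cs _))
    (s≤s (injective-coding⇒length≤ Code inj as! (cs ─ c∈cs) (restrict a∉as coded)))
  where
  restrict : ∀ {bs} → All (a ≢_) bs → All (λ b → ∃ λ d → d ∈ˡ cs × Code b d) bs →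
             All (λ b → ∃ λ d → d ∈ˡ (cs ─ c∈cs) × Code b d) bs
  restrict [] [] = []
  restrict (a≢b ∷ a≢bs) ((d , d∈cs , b↦d) ∷ rest) with ∈-─⁺ c∈cs d∈cs
  ... | inj₁ refl = contradiction (inj a↦c b↦d) a≢b
  ... | inj₂ d∈cs─c = (d , d∈cs─c , b↦d) ∷ restrict a≢bs rest

countIs-filter : {A : Set} {P : Pred A _} (P? : Decidable P) {xs : List A} →
  Unique xs → (∀ a → a ∈ˡ xs) → CountIs P (length (filter P? xs))
countIs-filter P? {xs} xs! complete =
  filter P? xs , Unique.filter⁺ P? xs! , refl ,
  λ a → (∈-filter⁺ P? (complete a)) , (proj₂ ∘ ∈-filter⁻ P? {xs = xs})

length-concatMap≤ : {A B : Set} (f : A → List B) {s : ℕ} → (∀ a → length (f a) ≤ s) →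
  (as : List A) → length (concatMap f as) ≤ length as * s
length-concatMap≤ f f≤s [] = z≤n
length-concatMap≤ f f≤s (a ∷ as) =
  subst (_≤ _) (sym (length-++ (f a))) (+-mono-≤ (f≤s a) (length-concatMap≤ f f≤s as))

length-map-++ : {A B : Set} (f : A → B) (xs : List A) {ys : List B} →
                length (map f xs ++ ys) ≡ length xs + length ys
length-map-++ f xs {ys} = trans (length-++ (map f xs)) (cong (_+ length ys) (length-map f xs))

≤-foldr-⊔ : {A : Set} (g : A → ℚ) {a : A} {as : List A} → a ∈ˡ as →
            g a ℚ.≤ foldr ℚ._⊔_ 0ℚ (map g as)
≤-foldr-⊔ g (here refl) = ℚ.p≤p⊔q (g _) _
≤-foldr-⊔ g {as = b ∷ _} (there a∈as) = ℚ.≤-trans (≤-foldr-⊔ g a∈as) (ℚ.p≤q⊔p (g b) _)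

elements : ∀ {n} → Subset n → List (Fin n)
elements []            = []
elements (inside ∷ p)  = zero ∷ map suc (elements p)
elements (outside ∷ p) = map suc (elements p)

length-elements : ∀ {n} (p : Subset n) → length (elements p) ≡ ∣ p ∣
length-elements []            = refl
length-elements (inside ∷ p)  = cong suc (trans (length-map suc (elements p)) (length-elements p))
length-elements (outside ∷ p) = trans (length-map suc (elements p)) (length-elements p)

∈-elements : ∀ {n} {p : Subset n} {i} → i ∈ p → i ∈ˡ elements p
∈-elements {p = inside ∷ p}  here        = here refl
∈-elements {p = inside ∷ p}  (there i∈p) = there (∈-map⁺ suc (∈-elements i∈p))
∈-elements {p = outside ∷ p} (there i∈p) = ∈-map⁺ suc (∈-elements i∈p)

allSubsets : ∀ n → List (Subset n)
allSubsets zero    = [] ∷ []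
allSubsets (suc n) = map (outside ∷_) (allSubsets n) ++ map (inside ∷_) (allSubsets n)

∈-allSubsets : ∀ {n} (p : Subset n) → p ∈ˡ allSubsets n
∈-allSubsets []            = here refl
∈-allSubsets (outside ∷ p) = ∈-++⁺ˡ (∈-map⁺ (outside ∷_) (∈-allSubsets p))
∈-allSubsets (inside ∷ p)  = ∈-++⁺ʳ _ (∈-map⁺ (inside ∷_) (∈-allSubsets p))

allSubsets-unique : ∀ n → Unique (allSubsets n)
allSubsets-unique zero    = [] ∷ []
allSubsets-unique (suc n) =
  Unique.++⁺ (Unique.map⁺ ∷-injectiveʳ (allSubsets-unique n))
             (Unique.map⁺ ∷-injectiveʳ (allSubsets-unique n)) heads-differ
  where
  ∷-injectiveʳ : ∀ {b : Bool} {p q : Subset n} → b ∷ p ≡ b ∷ q → p ≡ q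
  ∷-injectiveʳ refl = refl
  heads-differ : ∀ {p} → ¬ (p ∈ˡ map (outside ∷_) (allSubsets n) × p ∈ˡ map (inside ∷_) (allSubsets n))
  heads-differ (out , in') with ∈-map⁻ (outside ∷_) out | ∈-map⁻ (inside ∷_) in'
  ... | _ , _ , refl | _ , _ , ()

module _ {n : ℕ} {ℓ : Level} {P : Pred (Fin n) ℓ} (P? : Decidable P) where

  selection : Subset n
  selection = tabulate λ i → if does (P? i) then inside else outside

  ∈-selection⁺ : ∀ {i} → P i → i ∈ selection
  ∈-selection⁺ {i} Pi = lookup⇒[]= i selection (trans (lookup∘tabulate _ i) decided-inside)
    where
    decided-inside : (if does (P? i) then inside else outside) ≡ inside
    decided-inside with P? i
    ... | yes _  = refl
    ... | no ¬Pi = contradiction Pi ¬Pi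

  ∈-selection⁻ : ∀ {i} → i ∈ selection → P i
  ∈-selection⁻ {i} i∈sel with P? i | trans (sym (lookup∘tabulate _ i)) ([]=⇒lookup i∈sel)
  ... | yes Pi | _  = Pi
  ... | no _   | ()

Maximal : ∀ {n ℓ} → Pred (Subset n) ℓ → Subset n → Set ℓ
Maximal P p = ∀ q → P q → p ⊆ q → q ≡ p

module _ {n ℓ} {P : Pred (Subset n) ℓ} (P? : Decidable P) where

  no-larger⇒Maximal : ∀ {p} → ¬ (∃ λ q → P q × p ⊂ q) → Maximal P p
  no-larger⇒Maximal {p} no-larger q Pq p⊆q = ⊆-antisym q⊆p p⊆q
    where
    q⊆p : q ⊆ p
    q⊆p {i} i∈q = decidable-stable (i ∈? p) λ i∉p → no-larger (q , Pq , p⊆q , i , i∈q , i∉p)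

  maximal? : ∀ p → Dec (Maximal P p)
  maximal? p = Dec.map′ no-larger⇒Maximal Maximal⇒no-larger (¬? (anySubset? λ q → P? q ×-dec p ⊂? q))
    where
    Maximal⇒no-larger : Maximal P p → ¬ (∃ λ q → P q × p ⊂ q)
    Maximal⇒no-larger max (q , Pq , p⊆q , i , i∈q , i∉p) with max q Pq p⊆q
    ... | refl = i∉p i∈q

  maximal-above : ∀ {p} → P p → ∃ λ q → P q × p ⊆ q × Maximal P q
  maximal-above {p} Pp = go p (⊃-wellFounded p) Pp
    where
    go : ∀ p → Acc _⊃_ p → P p → ∃ λ q → P q × p ⊆ q × Maximal P q
    go p (acc larger) Pp with anySubset? (λ q → P? q ×-dec p ⊂? q)
    ... | yes (q , Pq , p⊂q) with go q (larger p⊂q) Pq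
    ...   | r , Pr , q⊆r , max = r , Pr , ⊆-trans (proj₁ p⊂q) q⊆r , max
    go p _ Pp | no no-larger = p , Pp , ⊆-refl , no-larger⇒Maximal no-larger

-- Rooted forests

module Forest {k : ℕ} (P : RootedForest k) where
  open RootedForest P

  depth-mono : ∀ {a b} → Anc P a b → depth a ≤ depth b
  depth-mono here                 = ≤-refl
  depth-mono (up {b = b} {c} e h) = <⇒≤ (≤-<-trans (depth-mono h) (depth-dec c b e))

  parent-irrefl : ∀ {a} → parent a ≢ just a
  parent-irrefl {a} e = <-irrefl refl (depth-dec a a e)

  Anc-antisym : ∀ {a b} → Anc P a b → Anc P b a → a ≡ b
  Anc-antisym here                 _  = refl
  Anc-antisym (up {b = b} {c} e h) h' =
    contradiction (≤-<-trans (depth-mono h) (depth-dec c b e)) (≤⇒≯ (depth-mono h'))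

  Anc-parent : ∀ {r w u} → Anc P r w → parent w ≡ just u → r ≡ w ⊎ Anc P r u
  Anc-parent here       _  = inj₁ refl
  Anc-parent (up e h) e' with trans (sym e) e'
  ... | refl = inj₂ h

  Anc-split : ∀ {a c} → Anc P a c → a ≡ c ⊎ ∃ λ y → parent y ≡ just a × Anc P y c
  Anc-split here      = inj₁ refl
  Anc-split (up e h) = inj₂ (child-toward h e)
    where
    child-toward : ∀ {a b c} → Anc P a b → parent c ≡ just b → ∃ λ y → parent y ≡ just a × Anc P y c
    child-toward here      e = _ , e , here
    child-toward (up e' h) e with child-toward h e'
    ... | y , y↑a , y≤c = y , y↑a , up e y≤c

  OnPath-branch : ∀ {a b x} → OnPath P a b x → Anc P x a → x ≢ a →
                  ∃ λ y → parent y ≡ just x × Anc P y a × ¬ Anc P y b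
  OnPath-branch {b = b} (_ , below-common) x≤a x≢a with Anc-split x≤a
  ... | inj₁ x≡a             = contradiction x≡a x≢a
  ... | inj₂ (y , y↑x , y≤a) = y , y↑x , y≤a , y≰b
    where
    y≰b : ¬ Anc P y b
    y≰b y≤b with Anc-antisym (below-common y y≤a y≤b) (up y↑x here)
    ... | refl = parent-irrefl y↑x

  Anc? : ∀ a b → Dec (Anc P a b)
  Anc? a b = go b (On.wellFounded depth <-wellFounded b)
    where
    go : ∀ c → Acc (_<_ on depth) c → Dec (Anc P a c)
    go c (acc above) with a ≟ᶠ c | parent c in eq
    ... | yes refl | _      = yes here
    ... | no a≢c   | nothing = no λ { here → a≢c refl ; (up e _) → contradiction (trans (sym eq) e) λ () }
    ... | no a≢c   | just p  =
      Dec.map′ (up eq) (λ a≤c → [ (λ a≡c → contradiction a≡c a≢c) , id ]′ (Anc-parent a≤c eq))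
               (go p (above (depth-dec c p eq)))

module _ {k : ℕ} (T : RootedTree k) where
  open RootedTree T
  open RootedForest forest

  root-Anc : ∀ z → Anc forest root z
  root-Anc z = go z (On.wellFounded depth <-wellFounded z)
    where
    go : ∀ z → Acc (_<_ on depth) z → Anc forest root z
    go z (acc above) with parent z in eq
    ... | nothing rewrite root-uniq z eq = here
    ... | just p  = up eq (go p (above (depth-dec z p eq)))

-- Tree decompositions

parent? : ∀ {k} (P : RootedForest k) x p → Dec (RootedForest.parent P x ≡ just p)
parent? P x p = Maybe.≡-dec _≟ᶠ_ (RootedForest.parent P x) (just p)

module Decomposition {H : Hypergraph} (t : TreeDec H) where
  open TreeDec t
  PT = RootedTree.forest T
  open RootedForest PT
  open Forest PT

  InMrg? : ∀ x v → Dec (InMrg t x v)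
  InMrg? x v = (v ∈? bag x) ×-dec ¬? ((v ∈? bag x) ×-dec
                                      any? λ p → parent? PT x p ×-dec (v ∈? bag p))

  InCmp? : ∀ x v → Dec (InCmp t x v)
  InCmp? x v = any? λ y → Anc? x y ×-dec InMrg? y v

  -- Otherwise the parent of a lies on the path from a to b, so u would be in adh(a).
  mrg-above-bag : ∀ {a b u} → InMrg t a u → u ∈ bag b → Anc PT a b
  mrg-above-bag {a} {b} {u} (u∈a , u∉adh) u∈b = decidable-stable (Anc? a b) λ a≰b →
    u∉adh (u∈a , parent-in-adhesion a≰b (parent a) refl)
    where
    parent-in-adhesion : ¬ Anc PT a b → ∀ mp → parent a ≡ mp → ∃ λ p → parent a ≡ just p × u ∈ bag p
    parent-in-adhesion a≰b nothing  a-root = contradiction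
      (subst (λ r → Anc PT r b) (sym (RootedTree.root-uniq T a a-root)) (root-Anc T b)) a≰b
    parent-in-adhesion a≰b (just p) a↑p =
      p , a↑p , connected u b a p u∈b u∈a (inj₂ (up a↑p here) , p-below)
      where
      p-below : ∀ w → Anc PT w b → Anc PT w a → Anc PT w p
      p-below w w≤b here         = contradiction w≤b a≰b
      p-below w w≤b (up a↑p' w≤p) with trans (sym a↑p') a↑p
      ... | refl = w≤p

  mrg-unique : ∀ {a b u} → InMrg t a u → InMrg t b u → a ≡ b
  mrg-unique u∈a u∈b = Anc-antisym (mrg-above-bag u∈a (proj₁ u∈b)) (mrg-above-bag u∈b (proj₁ u∈a))

  cmp⇒Anc : ∀ {x b v} → InCmp t x v → InMrg t b v → Anc PT x b
  cmp⇒Anc (c , x≤c , v∈c) v∈b with mrg-unique v∈c v∈b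
  ... | refl = x≤c

-- Factors of an elimination forest

module Factors {H : Hypergraph} (F : ElimForest H) where
  private
    N  = n H
    PF = ElimForest.forest F
  open RootedForest PF
  open Forest PF

  IsTreeFactor? : ∀ S → Dec (IsTreeFactor F S)
  IsTreeFactor? S = any? λ x → all? λ v → ((v ∈? S) →-dec Anc? x v) ×-dec (Anc? x v →-dec (v ∈? S))

  SiblingRoots? : ∀ R → Dec (SiblingRoots F R)
  SiblingRoots? R = nonempty? R ×-dec all? λ r → all? λ r' →
    (r ∈? R) →-dec ((r' ∈? R) →-dec Maybe.≡-dec _≟ᶠ_ (parent r) (parent r'))

  InUnion? : ∀ R v → Dec (InUnion F R v)
  InUnion? R v = any? λ r → (r ∈? R) ×-dec Anc? r v

  IsForestFactor? : ∀ S → Dec (IsForestFactor F S)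
  IsForestFactor? S = anySubset? λ R → SiblingRoots? R ×-dec
    all? λ v → ((v ∈? S) →-dec InUnion? R v) ×-dec (InUnion? R v →-dec (v ∈? S))

  IsContextFactor? : ∀ S → Dec (IsContextFactor F S)
  IsContextFactor? S = any? λ x → anySubset? λ R → SiblingRoots? R ×-dec
    (all? λ r → (r ∈? R) →-dec (Anc? x r ×-dec ¬? (r ≟ᶠ x))) ×-dec
    (all? λ v → ((v ∈? S) →-dec below x R v) ×-dec (below x R v →-dec (v ∈? S)))
    where below = λ x R v → Anc? x v ×-dec ¬? (InUnion? R v)

  IsFactor? : ∀ S → Dec (IsFactor F S)
  IsFactor? S = IsTreeFactor? S ⊎-dec IsForestFactor? S ⊎-dec IsContextFactor? S

  singleton-below : ∀ {w v} → v ∈ ⁅ w ⁆ → Anc PF w v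
  singleton-below {w} v∈ with x∈⁅y⁆⇒x≡y w v∈
  ... | refl = here

  singleton-factor : ∀ w → IsFactor F ⁅ w ⁆
  singleton-factor w with any? (λ c → parent? PF c w)
  ... | no no-child = inj₁ (w , λ v → singleton-below , only-w v)
    where
    only-w : ∀ v → Anc PF w v → v ∈ ⁅ w ⁆
    only-w v w≤v with Anc-split w≤v
    ... | inj₁ refl          = x∈⁅x⁆ w
    ... | inj₂ (y , y↑w , _) = contradiction (y , y↑w) no-child
  ... | yes (c , c↑w) =
    inj₂ (inj₂ (w , children , siblings , strictly-below , λ v → singleton-outside , only-w v))
    where
    child? = λ c → parent? PF c w
    children = selection child?
    siblings : SiblingRoots F children
    siblings = (c , ∈-selection⁺ child? c↑w) ,
               λ r r' r∈ r'∈ → trans (∈-selection⁻ child? r∈) (sym (∈-selection⁻ child? r'∈))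
    strictly-below : ∀ r → r ∈ children → Anc PF w r × r ≢ w
    strictly-below r r∈ = up (∈-selection⁻ child? r∈) here , λ { refl → parent-irrefl (∈-selection⁻ child? r∈) }
    singleton-outside : ∀ {v} → v ∈ ⁅ w ⁆ → Anc PF w v × ¬ InUnion F children v
    singleton-outside v∈ with x∈⁅y⁆⇒x≡y w v∈
    ... | refl = here , λ (r , r∈ , r≤w) →
      proj₂ (strictly-below r r∈) (Anc-antisym r≤w (proj₁ (strictly-below r r∈)))
    only-w : ∀ v → Anc PF w v × ¬ InUnion F children v → v ∈ ⁅ w ⁆
    only-w v (w≤v , v∉⋃) with Anc-split w≤v
    ... | inj₁ refl            = x∈⁅x⁆ w
    ... | inj₂ (y , y↑w , y≤v) = contradiction (y , ∈-selection⁺ child? y↑w , y≤v) v∉⋃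

  HoleAt : Subset N → Fin N → Set
  HoleAt S u = u ∈ S × ∃ λ v → parent v ≡ just u × v ∉ S

  HangsFrom : Subset N → Fin N → Set
  HangsFrom S u = u ∉ S × ∃ λ w → w ∈ S × parent w ≡ just u

  HoleAt⇒context : ∀ {S u} → IsFactor F S → HoleAt S u → IsContextFactor F S
  HoleAt⇒context (inj₁ (x , S≡Fx)) (u∈S , v , v↑u , v∉S) =
    contradiction (proj₂ (S≡Fx v) (up v↑u (proj₁ (S≡Fx _) u∈S))) v∉S
  HoleAt⇒context (inj₂ (inj₁ (R , _ , S≡FR))) (u∈S , v , v↑u , v∉S) with proj₁ (S≡FR _) u∈S
  ... | r , r∈R , r≤u = contradiction (proj₂ (S≡FR v) (r , r∈R , up v↑u r≤u)) v∉S
  HoleAt⇒context (inj₂ (inj₂ context)) _ = context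

  -- The child below a hole is one of the removed roots, since it is below x but not in S.
  HoleAt⇒root : ∀ {S u} (ctx : IsContextFactor F S) → HoleAt S u →
                ∃ λ r → r ∈ proj₁ (proj₂ ctx) × parent r ≡ just u
  HoleAt⇒root (x , R , _ , _ , S≡Fx─FR) (u∈S , v , v↑u , v∉S) with proj₁ (S≡Fx─FR _) u∈S
  ... | x≤u , u∉⋃R
    with decidable-stable (InUnion? R v) (λ v∉⋃R → v∉S (proj₂ (S≡Fx─FR v) (up v↑u x≤u , v∉⋃R)))
  ...   | r , r∈R , r≤v with Anc-parent r≤v v↑u
  ...     | inj₁ refl = r , r∈R , v↑u
  ...     | inj₂ r≤u  = contradiction (r , r∈R , r≤u) u∉⋃R

  HoleAt-unique : ∀ {S u u'} → IsFactor F S → HoleAt S u → HoleAt S u' → u ≡ u'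
  HoleAt-unique isF hole hole' with HoleAt⇒context isF hole
  ... | ctx@(_ , _ , (_ , siblings) , _) with HoleAt⇒root ctx hole | HoleAt⇒root ctx hole'
  ...   | r , r∈R , r↑u | r' , r'∈R , r'↑u' =
    just-injective (trans (sym r↑u) (trans (siblings r r' r∈R r'∈R) r'↑u'))

  hanging-point : ∀ {S} → IsFactor F S → ∃ λ top → ∀ {u} → HangsFrom S u → parent top ≡ just u
  hanging-point (inj₁ (x , S≡Fx)) = x , λ (u∉S , w , w∈S , w↑u) →
    [ (λ { refl → w↑u }) , (λ x≤u → contradiction (proj₂ (S≡Fx _) x≤u) u∉S) ]′
      (Anc-parent (proj₁ (S≡Fx w) w∈S) w↑u)
  hanging-point (inj₂ (inj₁ (R , ((r₀ , r₀∈R) , siblings) , S≡FR))) = r₀ , from-root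
    where
    from-root : ∀ {u} → HangsFrom _ u → parent r₀ ≡ just u
    from-root (u∉S , w , w∈S , w↑u) with proj₁ (S≡FR w) w∈S
    ... | r , r∈R , r≤w with Anc-parent r≤w w↑u
    ...   | inj₁ refl = trans (siblings r₀ r r₀∈R r∈R) w↑u
    ...   | inj₂ r≤u  = contradiction (proj₂ (S≡FR _) (r , r∈R , r≤u)) u∉S
  hanging-point (inj₂ (inj₂ (x , R , _ , _ , S≡Fx─FR))) = x , from-top
    where
    from-top : ∀ {u} → HangsFrom _ u → parent x ≡ just u
    from-top (u∉S , w , w∈S , w↑u) with proj₁ (S≡Fx─FR w) w∈S
    ... | x≤w , w∉⋃R with Anc-parent x≤w w↑u
    ...   | inj₁ refl = w↑u
    ...   | inj₂ x≤u  = contradiction (proj₂ (S≡Fx─FR _) (x≤u , u∉⋃R)) u∉S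
      where
      u∉⋃R : ¬ InUnion F R _
      u∉⋃R (r , r∈R , r≤u) = w∉⋃R (r , r∈R , up w↑u r≤u)

  HangsFrom-unique : ∀ {S u u'} → IsFactor F S → HangsFrom S u → HangsFrom S u' → u ≡ u'
  HangsFrom-unique isF hangs hangs' with hanging-point isF
  ... | _ , top↑ = just-injective (trans (sym (top↑ hangs)) (top↑ hangs'))

  module _ {U : Fin N → Set} (U? : Decidable U) where

    FactorIn : Subset N → Set
    FactorIn S = IsFactor F S × (∀ v → v ∈ S → U v)

    FactorIn? : Decidable FactorIn
    FactorIn? S = IsFactor? S ×-dec all? λ v → (v ∈? S) →-dec U? v

    Maximal⇒InMF : ∀ {S} → FactorIn S → Maximal FactorIn S → InMF F U S
    Maximal⇒InMF (isF , S⊆U) max = isF , S⊆U , λ S' isF' S⊆S' S'⊆U → max S' (isF' , S'⊆U) S⊆S'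

    InMF⇒Maximal : ∀ {S} → InMF F U S → FactorIn S × Maximal FactorIn S
    InMF⇒Maximal (isF , S⊆U , max) = (isF , S⊆U) , λ S' (isF' , S'⊆U) S⊆S' → max S' isF' S⊆S' S'⊆U

    InMF? : ∀ S → Dec (InMF F U S)
    InMF? S = Dec.map′ (λ (f , m) → Maximal⇒InMF f m) InMF⇒Maximal
                       (FactorIn? S ×-dec maximal? FactorIn? S)

    WellFormed? : Dec (WellFormed F U)
    WellFormed? with anySubset? (λ S → InMF? S ×-dec IsContextFactor? S)
    ... | yes (S , S∈MF , ctx) = no λ wf → wf S S∈MF ctx
    ... | no ¬bad = yes λ S S∈MF ctx → ¬bad (S , S∈MF , ctx)

    MF-exists : ∀ {w} → U w → ∃ λ S → InMF F U S × w ∈ S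
    MF-exists {w} Uw
      with maximal-above FactorIn? {⁅ w ⁆} (singleton-factor w , λ v v∈ → subst U (sym (x∈⁅y⁆⇒x≡y w v∈)) Uw)
    ... | S , S-factor , w⊆S , max = S , Maximal⇒InMF S-factor max , w⊆S (x∈⁅x⁆ w)

    MF-hole : ∀ {u v} → U u → parent v ≡ just u → ¬ U v → ∃ λ S → InMF F U S × HoleAt S u
    MF-hole Uu v↑u ¬Uv with MF-exists Uu
    ... | S , S∈MF@(_ , S⊆U , _) , u∈S = S , S∈MF , u∈S , _ , v↑u , λ v∈S → ¬Uv (S⊆U _ v∈S)

    MF-hangs : ∀ {u v} → U v → parent v ≡ just u → ¬ U u → ∃ λ S → InMF F U S × HangsFrom S u
    MF-hangs Uv v↑u ¬Uu with MF-exists Uv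
    ... | S , S∈MF@(_ , S⊆U , _) , v∈S = S , S∈MF , (λ u∈S → ¬Uu (S⊆U _ u∈S)) , _ , v∈S , v↑u

-- Degrees in the stain graph

bag-size≤ : {f : WidthFunction} (man : Manageable f) {H : Hypergraph} (t : TreeDec H)
            (x : Fin (TreeDec.m t)) → ∣ TreeDec.bag t x ∣ ≤ Manageable.β man (fwidth f t) (rank H)
bag-size≤ {f} man {H} t x =
  Manageable.β-bound man H (bag x) (fwidth f t) (≤-foldr-⊔ (f H ∘ bag) (∈-allFin x))
  where open TreeDec t

module StainDegree {H : Hypergraph} (t : TreeDec H) (F : ElimForest H) (x : Fin (TreeDec.m t)) where
  open TreeDec t
  open Decomposition t
  open Factors F
  open Forest PT using (OnPath-branch; Anc?)
  private
    N  = n H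
    PF = ElimForest.forest F

  data Code : Set where
    vertex    : Fin N → Code
    parentOf  : Fin N → Code
    holeAt    : Subset N → Code
    hangsFrom : Subset N → Code

  Encodes : Fin N → Code → Set
  Encodes u (vertex w)    = w ≡ u
  Encodes u (parentOf v)  = RootedForest.parent PF v ≡ just u
  Encodes u (holeAt S)    = IsFactor F S × HoleAt S u
  Encodes u (hangsFrom S) = IsFactor F S × HangsFrom S u

  Encodes-injective : ∀ {u u' c} → Encodes u c → Encodes u' c → u ≡ u'
  Encodes-injective {c = vertex _}    refl     refl      = refl
  Encodes-injective {c = parentOf _}  v↑u      v↑u'      = just-injective (trans (sym v↑u) v↑u')
  Encodes-injective {c = holeAt _}    (isF , h) (_ , h') = HoleAt-unique isF h h'
  Encodes-injective {c = hangsFrom _} (isF , h) (_ , h') = HangsFrom-unique isF h h'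

  opaque
    MFs : Fin m → List (Subset N)
    MFs y = filter (InMF? (InCmp? y)) (allSubsets N)

    MFs-count : ∀ y → CountIs (InMF F (InCmp t y)) (length (MFs y))
    MFs-count y = countIs-filter (InMF? (InCmp? y)) (allSubsets-unique N) ∈-allSubsets

    ∈-MFs : ∀ {y S} → InMF F (InCmp t y) S → S ∈ˡ MFs y
    ∈-MFs {y} {S} = ∈-filter⁺ (InMF? (InCmp? y)) (∈-allSubsets S)

  IllFormedChild : Fin m → Set
  IllFormedChild y = ChildT t y x × ¬ WellFormed F (InCmp t y)

  IllFormedChild? : Decidable IllFormedChild
  IllFormedChild? y = parent? PT y x ×-dec ¬? (WellFormed? (InCmp? y))

  opaque
    illFormedChildren : List (Fin m)
    illFormedChildren = filter IllFormedChild? (allFin m)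

    illFormedChildren-count : CountIs IllFormedChild (length illFormedChildren)
    illFormedChildren-count = countIs-filter IllFormedChild? (Unique.allFin⁺ m) ∈-allFin

    ∈-illFormedChildren : ∀ {y} → IllFormedChild y → y ∈ˡ illFormedChildren
    ∈-illFormedChildren {y} = ∈-filter⁺ IllFormedChild? (∈-allFin y)

  holeFactors : List (Subset N)
  holeFactors = MFs x ++ concatMap MFs illFormedChildren

  vertexCodes parentCodes holeCodes hangCodes codes : List Code
  vertexCodes = map vertex (elements (bag x))
  parentCodes = map parentOf (elements (bag x))
  holeCodes   = map holeAt holeFactors
  hangCodes   = map hangsFrom (MFs x)
  codes       = vertexCodes ++ parentCodes ++ holeCodes ++ hangCodes

  Coded : Fin N → Set
  Coded u = ∃ λ c → c ∈ˡ codes × Encodes u c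

  coded-vertex : ∀ {u} → u ∈ bag x → Coded u
  coded-vertex u∈x = _ , ∈-++⁺ˡ (∈-map⁺ vertex (∈-elements u∈x)) , refl

  coded-parent : ∀ {u v} → RootedForest.parent PF v ≡ just u → v ∈ bag x → Coded u
  coded-parent v↑u v∈x = _ , ∈-++⁺ʳ vertexCodes (∈-++⁺ˡ (∈-map⁺ parentOf (∈-elements v∈x))) , v↑u

  coded-hole : ∀ {u} → (∃ λ S → InMF F (InCmp t x) S × HoleAt S u) → Coded u
  coded-hole (S , S∈MF , hole) =
    _ , ∈-++⁺ʳ vertexCodes (∈-++⁺ʳ parentCodes (∈-++⁺ˡ (∈-map⁺ holeAt (∈-++⁺ˡ (∈-MFs S∈MF))))) ,
    proj₁ S∈MF , hole

  coded-hole-below : ∀ {u y} → ChildT t y x → (∃ λ S → InMF F (InCmp t y) S × HoleAt S u) → Coded u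
  coded-hole-below {y = y} y↑x (S , S∈MF , hole) =
    _ , ∈-++⁺ʳ vertexCodes (∈-++⁺ʳ parentCodes (∈-++⁺ˡ (∈-map⁺ holeAt (∈-++⁺ʳ (MFs x) S∈below)))) ,
    proj₁ S∈MF , hole
    where
    y-ill-formed : IllFormedChild y
    y-ill-formed = y↑x , λ wf → wf S S∈MF (HoleAt⇒context (proj₁ S∈MF) hole)
    S∈below : S ∈ˡ concatMap MFs illFormedChildren
    S∈below = ∈-concatMap⁺ MFs (Any.map (λ { refl → ∈-MFs S∈MF }) (∈-illFormedChildren y-ill-formed))

  coded-hangs : ∀ {u} → (∃ λ S → InMF F (InCmp t x) S × HangsFrom S u) → Coded u
  coded-hangs (S , S∈MF , hangs) =
    _ , ∈-++⁺ʳ vertexCodes (∈-++⁺ʳ parentCodes (∈-++⁺ʳ holeCodes (∈-map⁺ hangsFrom (∈-MFs S∈MF)))) ,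
    proj₁ S∈MF , hangs

  path-coded : ∀ {a b u v} → InMrg t a u → RootedForest.parent PF v ≡ just u → InMrg t b v →
               OnPath PT a b x → Coded u
  path-coded {a} {b} u∈a v↑u v∈b path = by-ends (x ≟ᶠ a) (x ≟ᶠ b)
    where
    v∉cmp : ∀ {y} → ¬ Anc PT y b → ¬ InCmp t y _
    v∉cmp y≰b v∈cmp = y≰b (cmp⇒Anc v∈cmp v∈b)

    u∉cmp : ∀ {y} → ¬ Anc PT y a → ¬ InCmp t y _
    u∉cmp y≰a u∈cmp = y≰a (cmp⇒Anc u∈cmp u∈a)

    by-position : x ≢ a → Dec (Anc PT x a) → Dec (Anc PT x b) → Coded _
    by-position _   (no x≰a)  (no x≰b)  = contradiction (proj₁ path) [ x≰a , x≰b ]′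
    by-position _   (yes x≤a) (no x≰b)  = coded-hole (MF-hole (InCmp? x) (a , x≤a , u∈a) v↑u (v∉cmp x≰b))
    by-position _   (no x≰a)  (yes x≤b) = coded-hangs (MF-hangs (InCmp? x) (b , x≤b , v∈b) v↑u (u∉cmp x≰a))
    by-position x≢a (yes x≤a) (yes _)   =
      let y , y↑x , y≤a , y≰b = OnPath-branch path x≤a x≢a
      in coded-hole-below y↑x (MF-hole (InCmp? y) (a , y≤a , u∈a) v↑u (v∉cmp y≰b))

    by-ends : Dec (x ≡ a) → Dec (x ≡ b) → Coded _
    by-ends (yes refl) _          = coded-vertex (proj₁ u∈a)
    by-ends (no _)     (yes refl) = coded-parent v↑u (proj₁ v∈b)
    by-ends (no x≢a)   (no _)     = by-position x≢a (Anc? x a) (Anc? x b)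

  stain-coded : ∀ {u} → InStain t F x u → Coded u
  stain-coded (_ , u∈a , inj₁ refl)                       = coded-vertex (proj₁ u∈a)
  stain-coded (_ , u∈a , inj₂ (_ , v↑u , _ , v∈b , path)) = path-coded u∈a v↑u v∈b path

  length-codes : length codes ≡ ∣ bag x ∣ + (∣ bag x ∣ + (length holeFactors + length (MFs x)))
  length-codes
    rewrite length-map-++ vertex (elements (bag x)) {parentCodes ++ holeCodes ++ hangCodes}
          | length-map-++ parentOf (elements (bag x)) {holeCodes ++ hangCodes}
          | length-map-++ holeAt holeFactors {hangCodes}
          | length-map hangsFrom (MFs x) | length-elements (bag x) = refl

  stain-degree≤ : ∀ {s mi} → IsSplit t F s → IsMir t F mi → ∀ {us} → Unique us → All (InStain t F x) us →
                  length us ≤ 2 * ∣ bag x ∣ + (2 + mi) * s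
  stain-degree≤ {s} {mi} split mir {us} us! stained = begin
    length us
      ≤⟨ injective-coding⇒length≤ Encodes Encodes-injective us! codes (All.map stain-coded stained) ⟩
    length codes
      ≡⟨ length-codes ⟩
    b + (b + (length holeFactors + length (MFs x)))
      ≤⟨ +-monoʳ-≤ b (+-monoʳ-≤ b (+-mono-≤ holeFactors≤ (MFs≤ x))) ⟩
    b + (b + ((s + mi * s) + s))
      ≡⟨ rearrange b s mi ⟩
    2 * b + (2 + mi) * s ∎
    where
    open ≤-Reasoning
    b = ∣ bag x ∣
    MFs≤ : ∀ y → length (MFs y) ≤ s
    MFs≤ y = proj₁ split y _ (MFs-count y)
    holeFactors≤ : length holeFactors ≤ s + mi * s
    holeFactors≤ = subst (_≤ s + mi * s) (sym (length-++ (MFs x)))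
      (+-mono-≤ (MFs≤ x) (≤-trans (length-concatMap≤ MFs MFs≤ illFormedChildren)
                                  (*-monoˡ-≤ s (proj₁ mir x _ illFormedChildren-count))))
    rearrange : ∀ b s mi → b + (b + ((s + mi * s) + s)) ≡ 2 * b + (2 + mi) * s
    rearrange = solve-∀

theorem55 : (f : WidthFunction) → Manageable f →
    Σ (ℕ → ℕ → ℚ → ℕ → ℕ) λ h →
      ∀ (H : Hypergraph) (t : TreeDec H) (F : ElimForest H) (s mi : ℕ) →
        IsSplit t F s → IsMir t F mi →
        ∀ (x : Fin (TreeDec.m t)) (us : List (Fin (n H))) →
          Unique us → All (InStain t F x) us →
          length us ≤ h s mi (fwidth f t) (rank H)
theorem55 f man = (λ s mi w r → 2 * Manageable.β man w r + (2 + mi) * s) ,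
  λ H t F s mi split mir x us us! stained →
    ≤-trans (StainDegree.stain-degree≤ t F x split mir us! stained)
            (+-monoˡ-≤ ((2 + mi) * s) (*-monoʳ-≤ 2 (bag-size≤ man t x)))
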